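{- Let $g$ be an $n$-person no-sink WTT game form which contains a $k$-box for some $1 \leq k \leq n$. Then $g$ contains a $(k-1)$-box or a $1$-box.
   Context: An $n$-person game form is a map $g : X_1 \times \cdots \times X_n \rightarrow A$ with finite nonempty sets; elements of $X = \prod X_m$ are strategy profiles. A line in direction $i$ is a set $\{x \in X : x_m = y_m \text{ for all } m \neq i\}$; a hyperplane perpendicular to direction $i$ is $\{x \in X : x_i = a\}$ for some $a \in X_i$; for a profile $x$, $H_i^x = \{z \in X : z_i = x_i\}$. $g$ is WTT if for every $i$, every two distinct $a, a' \in X_i$ and every two distinct $y, y' \in \prod_{m \neq i} X_m$, at least one of $g(a,y) = g(a,y')$, $g(a,y) = g(a',y)$, $g(a',y') = g(a',y)$, $g(a',y') = g(a,y')$ holds ($(a,y)$ is the profile with $i$-th coordinate $a$, others $y$). For distinct hyperplanes $H_j, H_k$ perpendicular to direction $i$ and a line $\ell$ in direction $i$ meeting them in $x_j^\ell, x_k^\ell$: $H_j^{\neq}(k) = \{x_j^\ell : g(x_j^\ell) \neq g(x_k^\ell)\}$. We write $H_j \stackrel{c}{\longrightarrow} H_k$ if $g(x) = c$ for all $x \in H_j^{\neq}(k)$, and $H_j \stackrel{c}{\Longrightarrow} H_k$ if $H_j \stackrel{c}{\longrightarrow} H_k$ and there is no outcome $d$ with $H_k \stackrel{d}{\longrightarrow} H_j$. An outcome $c$ is the proper outcome of $H_j$ if $H_j \stackrel{c}{\Longrightarrow} H_k$ for some parallel hyperplane $H_k \neq H_j$ (in a WTT game form this outcome is unique when it exists).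 $H_j$ is a sink hyperplane if for every other hyperplane $H_k$ parallel to it there is $c_k$ with $H_k \stackrel{c_k}{\longrightarrow} H_j$; $g$ is no-sink if there is no sink hyperplane in any direction (then in a WTT game form every hyperplane has a proper outcome). $g$ contains a $k$-box if there exist profiles $x, y$ with $g(x) \neq g(y)$, differing in exactly $k$ coordinates $i_1, \ldots, i_k$, such that for every $1 \leq t \leq k$, $g(x)$ is not the proper outcome of $H_{i_t}^x$ and $g(y)$ is not the proper outcome of $H_{i_t}^y$. -}

module Defs where

open import Data.Nat using (ℕ; _≤_)
open import Data.Fin using (Fin) renaming (_≟_ to _≟ᶠ_)
open import Data.Fin.Subset using (Subset; ∣_∣)
open import Data.Vec using (tabulate)
open import Data.Bool using (not)
open import Data.Product using (Σ; ∃; _×_)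
open import Data.Sum using (_⊎_)
open import Relation.Nullary using (¬_; does)
open import Relation.Binary.PropositionalEquality using (_≡_; _≢_)

-- Strategy sets X_i = Fin (s i) (finite; nonemptiness is a hypothesis of the theorem).
-- Strategy profiles: elements of X = ∏_i X_i.
Profile : {n : ℕ} → (Fin n → ℕ) → Set
Profile {n} s = (i : Fin n) → Fin (s i)

module GameForm {n : ℕ} {s : Fin n → ℕ} {m : ℕ} (g : Profile s → Fin m) where

  AgreeOff : Fin n → Profile s → Profile s → Set
  AgreeOff i x x' = ∀ j → j ≢ i → x j ≡ x' j

  -- WTT: for (a,y)=p, (a,y')=q, (a',y)=r, (a',y')=t with a ≢ a', y ≢ y'
  WTT : Set
  WTT = ∀ i (p q r t : Profile s) →
        p i ≡ q i → r i ≡ t i → p i ≢ r i →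
        AgreeOff i p r → AgreeOff i q t → ¬ AgreeOff i p q →
        (g p ≡ g q) ⊎ (g p ≡ g r) ⊎ (g t ≡ g r) ⊎ (g t ≡ g q)

  -- H_a →c H_b for hyperplanes {x i = a}, {x i = b} perpendicular to direction i:
  -- every x ∈ H_a^{≠}(b) has g x = c.
  Arrow : (i : Fin n) → Fin (s i) → Fin (s i) → Fin m → Set
  Arrow i a b c = ∀ (x x' : Profile s) → x i ≡ a → x' i ≡ b → AgreeOff i x x' →
                  g x ≢ g x' → g x ≡ c

  StrongArrow : (i : Fin n) → Fin (s i) → Fin (s i) → Fin m → Set
  StrongArrow i a b c = Arrow i a b c × ¬ (∃ λ d → Arrow i b a d)

  IsProper : (i : Fin n) → Fin (s i) → Fin m → Set
  IsProper i a c = ∃ λ b → b ≢ a × StrongArrow i a b c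

  Sink : (i : Fin n) → Fin (s i) → Set
  Sink i a = ∀ b → b ≢ a → ∃ λ c → Arrow i b a c

  NoSink : Set
  NoSink = ∀ i a → ¬ Sink i a

  DiffSet : Profile s → Profile s → Subset n
  DiffSet x y = tabulate (λ i → not (does (x i ≟ᶠ y i)))

  Box : ℕ → Set
  Box k = Σ (Profile s) λ x → Σ (Profile s) λ y →
          g x ≢ g y × ∣ DiffSet x y ∣ ≡ k ×
          (∀ i → x i ≢ y i → ¬ IsProper i (x i) (g x) × ¬ IsProper i (y i) (g y))

-- Take a k-box (x, y), a coordinate i in which x and y differ, and let z (resp. w) be x (resp. y)
-- with its i-th coordinate replaced by that of the other profile. If k ≥ 2, then x and w also
-- differ off direction i, so the WTT condition on the square x, w, z, y forces g z or g w to
-- coincide with g x or g y. Each coincidence exhibits a (k−1)-box, (z, y) or (w, x), or a 1-box,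
-- (x, z) or (y, w): improperness carries over because whether an outcome is proper depends only
-- on the hyperplane and the outcome.
module Submission where

open import Defs
open import Data.Nat using (ℕ; zero; suc; _≤_; _<_; _∸_; s≤s; z≤n)
import Data.Nat.Properties as ℕₚ
open import Data.Fin using (Fin; zero; suc; _≟_)
open import Data.Fin.Properties using (suc-injective)
open import Data.Fin.Subset using (∣_∣)
open import Data.Vec using (tabulate)
open import Data.Vec.Properties using (tabulate-cong)
open import Data.Bool using (Bool; true; false; not)
open import Data.Product using (∃; _×_; _,_)
open import Data.Sum using (_⊎_; inj₁; inj₂)
open import Function using (_∘_; case_of_; mk⇔)
open import Relation.Nullary using (¬_; does; yes; no)
open import Relation.Nullary.Decidable using (dec-true; dec-false; does-⇔)
open import Relation.Binary.PropositionalEquality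

∣tabulate-false∣≡0 : ∀ n → ∣ tabulate {n = n} (λ _ → false) ∣ ≡ 0
∣tabulate-false∣≡0 zero    = refl
∣tabulate-false∣≡0 (suc n) = ∣tabulate-false∣≡0 n

∣tabulate∣-witness : ∀ {n} (f : Fin n → Bool) → 0 < ∣ tabulate f ∣ → ∃ λ i → f i ≡ true
∣tabulate∣-witness {suc n} f pos with f zero in fzero
... | true  = zero , fzero
... | false with i , fi ← ∣tabulate∣-witness (f ∘ suc) pos = suc i , fi

∣tabulate∣-drop : ∀ {n} (f f' : Fin n → Bool) i → f i ≡ true → f' i ≡ false →
                  (∀ j → j ≢ i → f j ≡ f' j) → ∣ tabulate f ∣ ≡ suc ∣ tabulate f' ∣
∣tabulate∣-drop {suc n} f f' zero fi f'i agree rewrite fi | f'i =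
  cong suc (cong ∣_∣ (tabulate-cong λ j → agree (suc j) λ ()))
∣tabulate∣-drop {suc n} f f' (suc i) fi f'i agree with f zero | f' zero | agree zero (λ ())
... | true  | .true  | refl = cong suc (∣tabulate∣-drop (f ∘ suc) (f' ∘ suc) i fi f'i
                                          λ j j≢i → agree (suc j) (j≢i ∘ suc-injective))
... | false | .false | refl = ∣tabulate∣-drop (f ∘ suc) (f' ∘ suc) i fi f'i
                                 λ j j≢i → agree (suc j) (j≢i ∘ suc-injective)

module _ {k : ℕ} {a b : Fin k} where

  differs : a ≢ b → not (does (a ≟ b)) ≡ true
  differs a≢b = cong not (dec-false (a ≟ b) a≢b)

  agrees : a ≡ b → not (does (a ≟ b)) ≡ false
  agrees a≡b = cong not (dec-true (a ≟ b) a≡b)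

  differs⁻¹ : not (does (a ≟ b)) ≡ true → a ≢ b
  differs⁻¹ t a≡b = case trans (sym t) (agrees a≡b) of λ ()

module _ {n : ℕ} {s : Fin n → ℕ} where

  _[_]≔_ : Profile s → (i : Fin n) → Fin (s i) → Profile s
  (x [ i ]≔ a) j with j ≟ i
  ... | yes refl = a
  ... | no _     = x j

  update-same : ∀ x i (a : Fin (s i)) → (x [ i ]≔ a) i ≡ a
  update-same x i a with i ≟ i
  ... | yes refl = refl
  ... | no i≢i   = case i≢i refl of λ ()

  update-other : ∀ x {i} (a : Fin (s i)) {j} → j ≢ i → (x [ i ]≔ a) j ≡ x j
  update-other x {i} a {j} j≢i with j ≟ i
  ... | yes j≡i = case j≢i j≡i of λ ()
  ... | no _    = refl

module BoxShrinking {n : ℕ} {s : Fin n → ℕ} {m : ℕ} (g : Profile s → Fin m) where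
  open GameForm g

  DiffSet-sym : ∀ x y → DiffSet x y ≡ DiffSet y x
  DiffSet-sym x y = tabulate-cong λ i → cong not (does-⇔ (mk⇔ sym sym) (x i ≟ y i) (y i ≟ x i))

  DiffSet-witness : ∀ {x y} → 0 < ∣ DiffSet x y ∣ → ∃ λ i → x i ≢ y i
  DiffSet-witness pos with i , d ← ∣tabulate∣-witness _ pos = i , differs⁻¹ d

  ∣DiffSet∣-update : ∀ x y {i} → x i ≢ y i → ∣ DiffSet x y ∣ ≡ suc ∣ DiffSet (x [ i ]≔ y i) y ∣
  ∣DiffSet∣-update x y {i} xi≢yi =
    ∣tabulate∣-drop _ _ i (differs xi≢yi) (agrees (update-same x i (y i)))
      λ j j≢i → cong (λ a → not (does (a ≟ y j))) (sym (update-other x (y i) j≢i))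

  ∣DiffSet∣-update-self : ∀ x {i} (a : Fin (s i)) → x i ≢ a → ∣ DiffSet x (x [ i ]≔ a) ∣ ≡ 1
  ∣DiffSet∣-update-self x {i} a xi≢a = begin
    ∣ DiffSet x (x [ i ]≔ a) ∣              ≡⟨ ∣tabulate∣-drop _ (λ _ → false) i
                                                  (differs λ xi≡zi → xi≢a (trans xi≡zi (update-same x i a)))
                                                  refl (λ j j≢i → agrees (sym (update-other x a j≢i))) ⟩
    suc ∣ tabulate {n = n} (λ _ → false) ∣  ≡⟨ cong suc (∣tabulate-false∣≡0 n) ⟩
    1                                       ∎
    where open ≡-Reasoning

  DiffSet-second-witness : ∀ {x y k i} → ∣ DiffSet x y ∣ ≡ suc (suc k) → x i ≢ y i →
                           ∃ λ j → j ≢ i × x j ≢ y j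
  DiffSet-second-witness {x} {y} {i = i} size xi≢yi
    with j , zj≢yj ← DiffSet-witness {x [ i ]≔ y i} {y}
           (subst (0 <_) (ℕₚ.suc-injective (trans (sym size) (∣DiffSet∣-update x y xi≢yi))) (s≤s z≤n))
    = j , j≢i , subst (_≢ y j) (update-other x (y i) j≢i) zj≢yj
    where
    j≢i : j ≢ i
    j≢i refl = zj≢yj (update-same x i (y i))

  Improper : Fin n → Profile s → Set
  Improper i x = ¬ IsProper i (x i) (g x)

  improper-transfer : ∀ {i x x'} → x i ≡ x' i → g x ≡ g x' → Improper i x → Improper i x'
  improper-transfer xi≡x'i gx≡gx' = subst₂ (λ a c → ¬ IsProper _ a c) xi≡x'i gx≡gx'

  IsBox : ℕ → Profile s → Profile s → Set
  IsBox k x y = g x ≢ g y × ∣ DiffSet x y ∣ ≡ k × (∀ i → x i ≢ y i → Improper i x × Improper i y)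

  IsBox-sym : ∀ {k x y} → IsBox k x y → IsBox k y x
  IsBox-sym {x = x} {y} (gx≢gy , size , improper) =
      ≢-sym gx≢gy
    , trans (cong ∣_∣ (DiffSet-sym y x)) size
    , λ i yi≢xi → let (ix , iy) = improper i (≢-sym yi≢xi) in iy , ix

  IsBox-shrink : ∀ {k x y i} → IsBox (suc k) x y → x i ≢ y i → g x ≡ g (x [ i ]≔ y i) →
                 IsBox k (x [ i ]≔ y i) y
  IsBox-shrink {x = x} {y} {i} (gx≢gy , size , improper) xi≢yi gx≡gz =
      gx≢gy ∘ trans gx≡gz
    , ℕₚ.suc-injective (trans (sym (∣DiffSet∣-update x y xi≢yi)) size)
    , improper′
    where
    improper′ : ∀ j → (x [ i ]≔ y i) j ≢ y j → Improper j (x [ i ]≔ y i) × Improper j y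
    improper′ j zj≢yj = case j ≟ i of λ where
      (yes refl) → case zj≢yj (update-same x i (y i)) of λ ()
      (no j≢i)   →
        let xj≡zj = sym (update-other x (y i) j≢i)
            (ix , iy) = improper j (subst (_≢ y j) (sym xj≡zj) zj≢yj)
        in improper-transfer xj≡zj gx≡gz ix , iy

  IsBox-edge : ∀ {k x y i} → IsBox k x y → x i ≢ y i → g y ≡ g (x [ i ]≔ y i) →
               IsBox 1 x (x [ i ]≔ y i)
  IsBox-edge {x = x} {y} {i} (gx≢gy , _ , improper) xi≢yi gy≡gz =
      (λ gx≡gz → gx≢gy (trans gx≡gz (sym gy≡gz)))
    , ∣DiffSet∣-update-self x (y i) xi≢yi
    , improper′
    where
    improper′ : ∀ j → x j ≢ (x [ i ]≔ y i) j → Improper j x × Improper j (x [ i ]≔ y i)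
    improper′ j xj≢zj = case j ≟ i of λ where
      (no j≢i)   → case xj≢zj (sym (update-other x (y i) j≢i)) of λ ()
      (yes refl) →
        let (ix , iy) = improper j xi≢yi
        in ix , improper-transfer (sym (update-same x j (y j))) gy≡gz iy

  IsBox-split : ∀ {k x y i} → IsBox (suc k) x y → x i ≢ y i →
                g x ≡ g (x [ i ]≔ y i) ⊎ g y ≡ g (x [ i ]≔ y i) → Box k ⊎ Box 1
  IsBox-split {y = y} box xi≢yi (inj₁ gx≡gz) = inj₁ (_ , y , IsBox-shrink box xi≢yi gx≡gz)
  IsBox-split {x = x} box xi≢yi (inj₂ gy≡gz) = inj₂ (x , _ , IsBox-edge box xi≢yi gy≡gz)

  WTT-cross : WTT → ∀ {x y i j} → x i ≢ y i → j ≢ i → x j ≢ y j →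
              let z = x [ i ]≔ y i; w = y [ i ]≔ x i in
              g x ≡ g w ⊎ g x ≡ g z ⊎ g y ≡ g z ⊎ g y ≡ g w
  WTT-cross wtt {x} {y} {i} {j} xi≢yi j≢i xj≢yj =
    wtt i x (y [ i ]≔ x i) (x [ i ]≔ y i) y
      (sym (update-same y i (x i))) (update-same x i (y i))
      (λ xi≡zi → xi≢yi (trans xi≡zi (update-same x i (y i))))
      (λ _ → sym ∘ update-other x (y i)) (λ _ → update-other y (x i))
      (λ x≈w → xj≢yj (trans (x≈w j j≢i) (update-other y (x i) j≢i)))

  box-shrinks : WTT → ∀ {k x y} → IsBox (suc k) x y → Box k ⊎ Box 1
  box-shrinks _ {zero} {x} {y} box = inj₂ (x , y , box)
  box-shrinks wtt {suc _} box@(_ , size , _)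
    with i , xi≢yi ← DiffSet-witness (subst (0 <_) (sym size) (s≤s z≤n))
    with j , j≢i , xj≢yj ← DiffSet-second-witness size xi≢yi
    with WTT-cross wtt xi≢yi j≢i xj≢yj
  ... | inj₁ gx≡gw               = IsBox-split (IsBox-sym box) (≢-sym xi≢yi) (inj₂ gx≡gw)
  ... | inj₂ (inj₁ gx≡gz)        = IsBox-split box xi≢yi (inj₁ gx≡gz)
  ... | inj₂ (inj₂ (inj₁ gy≡gz)) = IsBox-split box xi≢yi (inj₂ gy≡gz)
  ... | inj₂ (inj₂ (inj₂ gy≡gw)) = IsBox-split (IsBox-sym box) (≢-sym xi≢yi) (inj₁ gy≡gw)

lemma4 : (n : ℕ) (s : Fin n → ℕ) (nonempty : ∀ i → 1 ≤ s i) (m : ℕ)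
    (g : Profile s → Fin m) → GameForm.WTT g → GameForm.NoSink g →
    (k : ℕ) → 1 ≤ k → k ≤ n → GameForm.Box g k →
    GameForm.Box g (k ∸ 1) ⊎ GameForm.Box g 1
lemma4 _ _ _ _ g wtt _ zero    ()
lemma4 _ _ _ _ g wtt _ (suc _) _ _ (_ , _ , box) = BoxShrinking.box-shrinks g wtt box
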